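{- Let $\Gamma$ be an infinite abelian group, $F\colon\Gamma\to\Gamma$ an injective endomorphism, and $A\subseteq\Gamma$ an $F$-sparse set. Then there is $s_0\in\mathbb{N}$, $s_0>0$, such that for every positive $s\in s_0\mathbb{N}$, $A$ can be written as a finite union of translates of sets of the form $[a_1^*\cdots a_n^*]_{F^s}=\{[a_1^{k_1}\cdots a_n^{k_n}]_{F^s}:k_1,\dots,k_n\in\mathbb{N}\}$ with $a_1,\dots,a_n\in\Gamma$.
   Context: For a string $\sigma=s_0\cdots s_n$ of elements of $\Gamma$ and an endomorphism $G$, $[\sigma]_G=s_0+Gs_1+\cdots+G^ns_n$; $[L]_G=\{[\sigma]_G:\sigma\in L\}$; $a^k$ is the string consisting of $k$ copies of $a$. $\Lambda^*$ denotes finite strings over $\Lambda$. A finite $\Sigma\subseteq\Gamma$ is a $G$-spanning set if: (i) every $a\in\Gamma$ equals $[\sigma]_G$ for some $\sigma\in\Sigma^*$; (ii) $0\in\Sigma$ and $\Sigma=-\Sigma$; (iii) for $a_1,\dots,a_5\in\Sigma$, $a_1+\cdots+a_5\in\Sigma+G\Sigma$; (iv) if $a_1,a_2,a_3\in\Sigma$ and $a_1+a_2+a_3\in G\Gamma$ then $a_1+a_2+a_3\in G\Sigma$. A language is sparse if it is regular and the number of its words of length $\le x$ is bounded by a polynomial in $x$. $A$ is $F$-sparse if there are $r>0$, an $F^r$-spanning set $\Sigma$ and a sparse $L\subseteq\Sigma^*$ with $A=[L]_{F^r}$. $\mathbb{N}$ includes $0$. -}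

module Defs where

open import Level using (Level; _⊔_) renaming (suc to lsuc)
open import Algebra.Bundles using (AbelianGroup)
open import Algebra.Morphism.Structures using (module GroupMorphisms)
open import Data.Nat using (ℕ; zero; suc; _≤_; _*_; _^_; _+_; _<_)
open import Data.Fin using (Fin)
open import Data.List using (List; []; _∷_; _++_; map; concatMap; filter; length; upTo; allFin)
open import Data.Nat.ListAction using (sum)
open import Data.List.Relation.Unary.All using (All)
open import Data.List.Relation.Unary.Any using (Any)
open import Data.Vec using (Vec; []; _∷_)
open import Data.Bool using (Bool; true; false; T)
open import Data.Product using (Σ; ∃; _×_; _,_)
open import Data.Empty using (⊥)
open import Relation.Nullary using (¬_)
open import Relation.Nullary.Decidable using (T?)
open import Function.Bundles using (_⇔_)
open import Function.Definitions using (Injective)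
open import Relation.Binary.PropositionalEquality using (_≡_)

iter : ∀ {a} {X : Set a} → (X → X) → ℕ → X → X
iter G zero    x = x
iter G (suc n) x = G (iter G n x)

rep : ∀ {a} {X : Set a} → ℕ → X → List X
rep zero    x = []
rep (suc k) x = x ∷ rep k x

powWord : ∀ {a} {X : Set a} {n : ℕ} → Vec ℕ n → Vec X n → List X
powWord []       []       = []
powWord (k ∷ ks) (x ∷ xs) = rep k x ++ powWord ks xs

-- Deterministic finite automata over the alphabet Fin m; regular
-- languages are exactly those recognised by such automata.

record DFA (m : ℕ) : Set where
  field
    nStates : ℕ
    start   : Fin nStates
    δ       : Fin nStates → Fin m → Fin nStates
    final   : Fin nStates → Bool

  run : Fin nStates → List (Fin m) → Fin nStates
  run q []       = q
  run q (x ∷ w)  = run (δ q x) w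

  accepts : List (Fin m) → Bool
  accepts w = final (run start w)

wordsOfLength : (m : ℕ) → ℕ → List (List (Fin m))
wordsOfLength m zero    = [] ∷ []
wordsOfLength m (suc n) =
  concatMap (λ x → map (x ∷_) (wordsOfLength m n)) (allFin m)

countUpTo : ∀ {m} → DFA m → ℕ → ℕ
countUpTo {m} D x =
  sum (map (λ n → length (filter (λ w → T? (DFA.accepts D w)) (wordsOfLength m n)))
           (upTo (suc x)))

Language : ℕ → (ℓ : Level) → Set (lsuc ℓ)
Language m ℓ = List (Fin m) → Set ℓ

Recognises : ∀ {m ℓ} → DFA m → Language m ℓ → Set ℓ
Recognises D L = ∀ w → L w ⇔ T (DFA.accepts D w)

Sparse : ∀ {m ℓ} → Language m ℓ → Set ℓ
Sparse {m} L = Σ (DFA m) λ D → Recognises D L ×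
  Σ ℕ λ C → Σ ℕ λ d → ∀ x → countUpTo D x ≤ C * (suc x) ^ d

module _ {c ℓ : Level} (Γ : AbelianGroup c ℓ) where
  open AbelianGroup Γ renaming (Carrier to G₀)
  open GroupMorphisms rawGroup rawGroup

  Infinite : Set (c ⊔ ℓ)
  Infinite = ¬ (Σ (List G₀) λ xs → ∀ x → Any (x ≈_) xs)

  InjectiveEndo : (G₀ → G₀) → Set (c ⊔ ℓ)
  InjectiveEndo F = IsGroupMonomorphism F

  -- [s_0 ⋯ s_n]_G = s_0 + G s_1 + ⋯ + G^n s_n
  eval : (G₀ → G₀) → List G₀ → G₀
  eval G []      = ε
  eval G (s ∷ σ) = s ∙ G (eval G σ)

  _∈ₛ_ : G₀ → List G₀ → Set (c ⊔ ℓ)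
  x ∈ₛ S = Any (x ≈_) S

  -- G-spanning set; the finite set Σ is given by an injective
  -- enumeration e : Fin m → Γ (its image)
  record IsSpanning (G : G₀ → G₀) (m : ℕ) (e : Fin m → G₀) : Set (c ⊔ ℓ) where
    S : List G₀
    S = map e (allFin m)
    field
      enum-injective : Injective _≡_ _≈_ e
      span      : ∀ a → Σ (List (Fin m)) λ w → eval G (map e w) ≈ a
      zero∈     : ε ∈ₛ S
      symmetric : ∀ a → a ∈ₛ S → (a ⁻¹) ∈ₛ S
      five      : ∀ a₁ a₂ a₃ a₄ a₅ → a₁ ∈ₛ S → a₂ ∈ₛ S → a₃ ∈ₛ S → a₄ ∈ₛ S → a₅ ∈ₛ S →
                  Σ G₀ λ b → Σ G₀ λ b′ → b ∈ₛ S × b′ ∈ₛ S ×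
                    (a₁ ∙ a₂ ∙ a₃ ∙ a₄ ∙ a₅ ≈ b ∙ G b′)
      three     : ∀ a₁ a₂ a₃ → a₁ ∈ₛ S → a₂ ∈ₛ S → a₃ ∈ₛ S →
                  (Σ G₀ λ g → a₁ ∙ a₂ ∙ a₃ ≈ G g) →
                  Σ G₀ λ b → b ∈ₛ S × (a₁ ∙ a₂ ∙ a₃ ≈ G b)

  FSparse : ∀ {a} → (G₀ → G₀) → (G₀ → Set a) → Set (c ⊔ ℓ ⊔ lsuc a)
  FSparse {a} F A =
    Σ ℕ λ r → 0 < r ×
    Σ ℕ λ m → Σ (Fin m → G₀) λ e → IsSpanning (iter F r) m e ×
    Σ (Language m a) λ L → Sparse L ×
    (∀ g → A g ⇔ (Σ (List (Fin m)) λ w → L w × (eval (iter F r) (map e w) ≈ g)))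

  -- a translate t + [a_1^* ⋯ a_n^*]_G, given by t, n and (a_1,…,a_n)
  record Piece : Set c where
    constructor piece
    field
      shift : G₀
      len   : ℕ
      gens  : Vec G₀ len

  InPiece : (G₀ → G₀) → Piece → G₀ → Set ℓ
  InPiece G (piece t n as) g =
    Σ (Vec ℕ n) λ ks → g ≈ t ∙ eval G (powWord ks as)

  FiniteUnionOfStarTranslates : ∀ {a} → (G₀ → G₀) → (G₀ → Set a) → Set (c ⊔ ℓ ⊔ a)
  FiniteUnionOfStarTranslates G A =
    Σ (List Piece) λ ps → ∀ g → A g ⇔ Any (λ p → InPiece G p g) ps

-- In a DFA whose language has polynomially many words of each length, two loops at a state that is
-- reachable and co-reachable commute: otherwise uv ≠ vu would be loops of equal length and their k-fold
-- products would give 2^k accepted words of linear length. So every loop at such a state q is a power of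
-- the shortest one, loop q, and every accepted word reads loop(q₀)^k₀ a₁ loop(q₁)^k₁ ⋯ aₙ loop(qₙ)^kₙ along
-- a path q₀ a₁ q₁ ⋯ aₙ qₙ through distinct states. If n! ∣ N then |loop q| ∣ N, and splitting each kᵢ
-- modulo N / |loop qᵢ| writes the language as a finite union of patterns u₀ P₁* u₁ ⋯ Pⱼ* uⱼ with all
-- |Pᵢ| = N. Under H = F^r a block Pᵏ telescopes to a translate of [bᵏ]_{H^N}, so each pattern is mapped
-- onto a translate of [b₁* ⋯ bⱼ*]_{F^{rN}}; hence s₀ = n! r works.

module Submission where

open import Defs
open import Level using (Level)
open import Algebra.Bundles using (AbelianGroup)
open import Data.Nat using (ℕ; _<_)
open import Data.Nat.Divisibility using (_∣_)
open import Data.Product using (Σ; _×_)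

open import Algebra.Morphism.Structures using (module MonoidMorphisms; module GroupMorphisms)
import Algebra.Morphism.Construct.Composition as Composition
import Algebra.Morphism.Construct.Identity as Identity
open import Data.Bool using (T)
open import Data.Empty using (⊥; ⊥-elim)
open import Data.Fin as Fin using (Fin; toℕ)
open import Data.Fin.Properties using (injective⇒≤; pigeonhole; toℕ<n)
open import Data.List as List
  using (List; []; _∷_; _++_; length; map; take; drop; lookup; filter; upTo; allFin; concatMap)
open import Data.List.Properties
  using (length-++; length-map; length-take; length-drop; length-tabulate; length-++-comm; ++-assoc; ++-identityʳ;
         ++-cancelˡ; ++-cancelʳ; take++drop≡id; map-++; ∷-injectiveˡ; ∷-injectiveʳ; ≡-dec)
open import Data.List.Membership.Propositional using (_∈_; _∉_; find; lose)
open import Data.List.Membership.Propositional.Properties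
  using (∈-lookup; ∈-map⁺; ∈-map⁻; ∈-filter⁺; ∈-filter⁻; ∈-upTo⁺; ∈-allFin; ∈-concatMap⁺; ∈-concatMap⁻)
import Data.List.Membership.DecPropositional as DecMembership
open import Data.List.Relation.Binary.Subset.Propositional using (_⊆_)
open import Data.List.Relation.Unary.All as All using (All; []; _∷_)
open import Data.List.Relation.Unary.All.Properties as All using (¬Any⇒All¬)
open import Data.List.Relation.Unary.AllPairs using ([]; _∷_)
open import Data.List.Relation.Unary.Any as Any using (Any; here; there; any?)
open import Data.List.Relation.Unary.Any.Properties as Any using (lookup-index)
open import Data.List.Relation.Unary.Unique.Propositional using (Unique)
import Data.List.Relation.Unary.Unique.Propositional.Properties as Unique
open import Data.Nat
open import Data.Nat.Properties
open import Data.Nat.DivMod using (m≡m%n+[m/n]*n; m%n<n; m/n*n≡m; m≥n⇒m/n>0)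
open import Data.Nat.Divisibility using (divides; ∣⇒≤; ∣-trans; m∣m*n; n∣m*n; m≤n⇒m!∣n!)
open import Data.Nat.Induction using (<-wellFounded)
open import Data.Nat.ListAction using (sum)
open import Data.Nat.Solver using (module +-*-Solver)
open import Data.Product using (_,_; proj₁; proj₂; map₁; map₂)
open import Data.Unit using (⊤; tt)
open import Data.Vec as Vec using (Vec; []; _∷_)
open import Function.Base using (_∘_)
open import Function.Bundles using (_⇔_; mk⇔; Equivalence)
import Function.Properties.Equivalence as ⇔
open import Induction.WellFounded using (Acc; acc)
open import Relation.Nullary using (Dec; yes; no)
open import Relation.Nullary.Decidable using (T?; map′)
open import Relation.Binary.PropositionalEquality
open +-*-Solver using (solve; _:+_; _:*_; _:=_; con)

n<2^n : ∀ n → n < 2 ^ n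
n<2^n zero    = z<s
n<2^n (suc n) = +-mono-≤ (m^n>0 2 n) (≤-trans (n<2^n n) (m≤m+n (2 ^ n) 0))

linear≤4^ : ∀ a b → let u = a + 2 * b in a + (u + u) * b ≤ 2 ^ (u + u)
linear≤4^ a b = begin
  a + (u + u) * b     ≤⟨ +-mono-≤ (m≤m+n a (2 * b)) (≤-reflexive 2u*b≡u*2b) ⟩
  u + u * (2 * b)     ≤⟨ +-monoʳ-≤ u (*-monoʳ-≤ u (m≤n+m (2 * b) a)) ⟩
  u + u * u           ≤⟨ +-mono-≤ (n≤1+n u) (*-monoʳ-≤ u (n≤1+n u)) ⟩
  suc u * suc u       ≤⟨ *-mono-≤ (n<2^n u) (n<2^n u) ⟩
  2 ^ u * 2 ^ u       ≡⟨ ^-distribˡ-+-* 2 u u ⟨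
  2 ^ (u + u)         ∎
  where
  open ≤-Reasoning
  u = a + 2 * b
  2u*b≡u*2b : (u + u) * b ≡ u * (2 * b)
  2u*b≡u*2b = solve 2 (λ u b → (u :+ u) :* b := u :* (con 2 :* b)) refl u b

-- k = 2^t, with t large enough that c + (1 + t + b)·d ≤ 2^t.
poly<2^ : ∀ c b d → Σ ℕ λ k → c * (suc k * b) ^ d < 2 ^ k
poly<2^ c b d = k , (begin-strict
  c * (suc k * b) ^ d            ≤⟨ *-monoʳ-≤ c (^-monoˡ-≤ d (*-mono-≤ 1+k≤2^[1+t] (<⇒≤ (n<2^n b)))) ⟩
  c * (2 ^ suc t * 2 ^ b) ^ d    ≡⟨ cong (λ x → c * x ^ d) (^-distribˡ-+-* 2 (suc t) b) ⟨
  c * (2 ^ e) ^ d                ≡⟨ cong (c *_) (^-*-assoc 2 e d) ⟩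
  c * 2 ^ (e * d)                <⟨ *-monoˡ-< (2 ^ (e * d)) {{m^n≢0 2 (e * d)}} (n<2^n c) ⟩
  2 ^ c * 2 ^ (e * d)            ≡⟨ ^-distribˡ-+-* 2 c (e * d) ⟨
  2 ^ (c + e * d)                ≤⟨ ^-monoʳ-≤ 2 exponent≤ ⟩
  2 ^ k                          ∎)
  where
  open ≤-Reasoning
  a = c + b * d + d
  u = a + 2 * d
  t = u + u
  k = 2 ^ t
  e = suc t + b
  1+k≤2^[1+t] : suc k ≤ 2 ^ suc t
  1+k≤2^[1+t] = +-mono-≤ (m^n>0 2 t) (m≤m+n k 0)
  exponent≤ : c + e * d ≤ k
  exponent≤ = begin
    c + (suc t + b) * d   ≡⟨ solve 4 (λ c b d t → c :+ ((con 1 :+ t) :+ b) :* d := (c :+ b :* d :+ d) :+ t :* d)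
                                    refl c b d t ⟩
    a + t * d             ≤⟨ linear≤4^ a d ⟩
    k                     ∎

exp-beats-poly : ∀ C d a L → Σ ℕ λ k → C * suc (a + k * L) ^ d < 2 ^ k
exp-beats-poly C d a L with poly<2^ C (suc (a + L)) d
... | k , poly<2^k = k , ≤-<-trans (*-monoʳ-≤ C (^-monoˡ-≤ d line≤)) poly<2^k
  where
  line≤ : suc (a + k * L) ≤ suc k * suc (a + L)
  line≤ = +-mono-≤ (s≤s (m≤m+n a L)) (*-monoʳ-≤ k (m≤n+m L (suc a)))

m≤n⇒m∣n! : ∀ {m n} → 0 < m → m ≤ n → m ∣ n !
m≤n⇒m∣n! {suc m} _ m≤n = ∣-trans (m∣m*n (m !)) (m≤n⇒m!∣n! m≤n)


module _ {a} {A : Set a} where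

  infixr 8 _^ʷ_
  _^ʷ_ : List A → ℕ → List A
  p ^ʷ zero  = []
  p ^ʷ suc k = p ++ p ^ʷ k

  ^ʷ-+ : ∀ p i j → p ^ʷ (i + j) ≡ p ^ʷ i ++ p ^ʷ j
  ^ʷ-+ p zero    j = refl
  ^ʷ-+ p (suc i) j = trans (cong (p ++_) (^ʷ-+ p i j)) (sym (++-assoc p (p ^ʷ i) (p ^ʷ j)))

  ^ʷ-* : ∀ p i j → p ^ʷ (i * j) ≡ (p ^ʷ j) ^ʷ i
  ^ʷ-* p zero    j = refl
  ^ʷ-* p (suc i) j = trans (^ʷ-+ p j (i * j)) (cong (p ^ʷ j ++_) (^ʷ-* p i j))

  length-^ʷ : ∀ p k → length (p ^ʷ k) ≡ k * length p
  length-^ʷ p zero    = refl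
  length-^ʷ p (suc k) = trans (length-++ p) (cong (length p +_) (length-^ʷ p k))

  []^ʷ : ∀ k → [] ^ʷ k ≡ []
  []^ʷ zero    = refl
  []^ʷ (suc k) = []^ʷ k

  ++-injectiveˡ : ∀ u v {x y : List A} → u ++ x ≡ v ++ y → length u ≡ length v → u ≡ v
  ++-injectiveˡ []      []      _  _   = refl
  ++-injectiveˡ (x ∷ u) (y ∷ v) eq len =
    cong₂ _∷_ (∷-injectiveˡ eq) (++-injectiveˡ u v (∷-injectiveʳ eq) (suc-injective len))

  commute⇒prefix : ∀ p w → p ++ w ≡ w ++ p → length p ≤ length w → w ≡ p ++ drop (length p) w
  commute⇒prefix p w comm p≤w = begin
    w                     ≡⟨ take++drop≡id (length p) w ⟨
    take (length p) w ++ w′ ≡⟨ cong (_++ w′) prefix ⟨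
    p ++ w′               ∎
    where
    open ≡-Reasoning
    w′ = drop (length p) w
    prefix : p ≡ take (length p) w
    prefix = ++-injectiveˡ p (take (length p) w)
      (trans comm (trans (cong (_++ p) (sym (take++drop≡id (length p) w))) (++-assoc _ w′ p)))
      (sym (trans (length-take (length p) w) (m≤n⇒m⊓n≡m p≤w)))

  lookup-injective : ∀ {xs : List A} → Unique xs → ∀ {i j} → lookup xs i ≡ lookup xs j → i ≡ j
  lookup-injective (_ ∷ _)     {Fin.zero}  {Fin.zero}  _  = refl
  lookup-injective (x≢ ∷ _)    {Fin.zero}  {Fin.suc j} eq = ⊥-elim (All.lookup x≢ (∈-lookup j) eq)
  lookup-injective (x≢ ∷ _)    {Fin.suc i} {Fin.zero}  eq = ⊥-elim (All.lookup x≢ (∈-lookup i) (sym eq))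
  lookup-injective (_ ∷ uniq)  {Fin.suc i} {Fin.suc j} eq = cong Fin.suc (lookup-injective uniq eq)

  Unique⇒length≤ : ∀ {xs ys : List A} → Unique xs → xs ⊆ ys → length xs ≤ length ys
  Unique⇒length≤ {xs} {ys} uniq xs⊆ys = injective⇒≤ {f = position} position-injective
    where
    position : Fin (length xs) → Fin (length ys)
    position i = Any.index (xs⊆ys (∈-lookup i))
    position-injective : ∀ {i j} → position i ≡ position j → i ≡ j
    position-injective {i} {j} eq = lookup-injective uniq (begin
      lookup xs i               ≡⟨ lookup-index (xs⊆ys (∈-lookup i)) ⟩
      lookup ys (position i)    ≡⟨ cong (lookup ys) eq ⟩
      lookup ys (position j)    ≡⟨ lookup-index (xs⊆ys (∈-lookup j)) ⟨
      lookup xs j               ∎)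
      where open ≡-Reasoning


∈⇒≤sum : ∀ {n ns} → n ∈ ns → n ≤ sum ns
∈⇒≤sum {ns = n ∷ ns} (here refl) = m≤m+n n (sum ns)
∈⇒≤sum {ns = k ∷ ns} (there n∈) = ≤-trans (∈⇒≤sum n∈) (m≤n+m (sum ns) k)

∈-wordsOfLength : ∀ {m} (w : List (Fin m)) → w ∈ wordsOfLength m (length w)
∈-wordsOfLength [] = here refl
∈-wordsOfLength {m} (a ∷ w) =
  ∈-concatMap⁺ (λ x → map (x ∷_) (wordsOfLength m (length w))) (lose (∈-allFin a) (∈-map⁺ (a ∷_) (∈-wordsOfLength w)))

∈-wordsOfLength⁻ : ∀ {m l} (w : List (Fin m)) → w ∈ wordsOfLength m l → length w ≡ l
∈-wordsOfLength⁻ {l = zero}  w (here refl) = refl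
∈-wordsOfLength⁻ {m} {suc l} w w∈ with find (∈-concatMap⁻ (λ x → map (x ∷_) (wordsOfLength m l)) {xs = allFin m} w∈)
... | a , _ , w∈a∷ with ∈-map⁻ (a ∷_) w∈a∷
...   | v , v∈ , refl = cong suc (∈-wordsOfLength⁻ v v∈)

module _ {A : Set} (u v : List A) where

  blockWords : ℕ → List (List A)
  blockWords zero    = [] ∷ []
  blockWords (suc k) = map (u ++_) (blockWords k) ++ map (v ++_) (blockWords k)

  length-blockWords : ∀ k → length (blockWords k) ≡ 2 ^ k
  length-blockWords zero    = refl
  length-blockWords (suc k) = begin
    length (map (u ++_) ws ++ map (v ++_) ws)         ≡⟨ length-++ (map (u ++_) ws) ⟩
    length (map (u ++_) ws) + length (map (v ++_) ws) ≡⟨ cong₂ _+_ (length-map _ ws) (length-map _ ws) ⟩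
    length ws + length ws                              ≡⟨ cong (λ n → n + n) (length-blockWords k) ⟩
    2 ^ k + 2 ^ k                                      ≡⟨ cong (2 ^ k +_) (+-identityʳ (2 ^ k)) ⟨
    2 ^ suc k                                          ∎
    where
    open ≡-Reasoning
    ws = blockWords k

  blockWords-unique : u ≢ v → length u ≡ length v → ∀ k → Unique (blockWords k)
  blockWords-unique u≢v |u|≡|v| zero    = [] ∷ []
  blockWords-unique u≢v |u|≡|v| (suc k) =
    Unique.++⁺ (Unique.map⁺ (++-cancelˡ u _ _) uniq) (Unique.map⁺ (++-cancelˡ v _ _) uniq) disjoint
    where
    uniq = blockWords-unique u≢v |u|≡|v| k
    disjoint : ∀ {w} → w ∈ map (u ++_) (blockWords k) × w ∈ map (v ++_) (blockWords k) → ⊥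
    disjoint (w∈u , w∈v) with ∈-map⁻ (u ++_) w∈u | ∈-map⁻ (v ++_) w∈v
    ... | _ , _ , refl | _ , _ , eq = u≢v (++-injectiveˡ u v eq |u|≡|v|)

  blockWords-All : ∀ {ℓ} (P : ℕ → List A → Set ℓ) → P 0 [] →
                   (∀ {k w} → P k w → P (suc k) (u ++ w)) → (∀ {k w} → P k w → P (suc k) (v ++ w)) →
                   ∀ k → All (P k) (blockWords k)
  blockWords-All P P[] Pu Pv zero    = P[] ∷ []
  blockWords-All P P[] Pu Pv (suc k) = All.++⁺ (All.map⁺ (All.map Pu ih)) (All.map⁺ (All.map Pv ih))
    where ih = blockWords-All P P[] Pu Pv k


Word : ℕ → Set
Word m = List (Fin m)

module _ {m : ℕ} (D : DFA m) where
  open DFA D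

  run-++ : ∀ q (u v : Word m) → run q (u ++ v) ≡ run (run q u) v
  run-++ q []      v = refl
  run-++ q (a ∷ u) v = run-++ (δ q a) u v

  loop-++ : ∀ {q} u v → run q u ≡ q → run q v ≡ q → run q (u ++ v) ≡ q
  loop-++ {q} u v u-loop v-loop = trans (run-++ q u v) (trans (cong (λ s → run s v) u-loop) v-loop)

  loop-^ʷ : ∀ {q} p → run q p ≡ q → ∀ k → run q (p ^ʷ k) ≡ q
  loop-^ʷ p p-loop zero    = refl
  loop-^ʷ p p-loop (suc k) = loop-++ p (p ^ʷ k) p-loop (loop-^ʷ p p-loop k)

  accepted-through-loop : ∀ {q} x y {w} → run start x ≡ q → T (final (run q y)) → run q w ≡ q →
                          T (accepts (x ++ w ++ y))
  accepted-through-loop {q} x y {w} x↦q q↦final w-loop = subst (λ s → T (final s)) (sym (begin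
    run start (x ++ w ++ y)    ≡⟨ run-++ start x (w ++ y) ⟩
    run (run start x) (w ++ y) ≡⟨ cong (λ s → run s (w ++ y)) x↦q ⟩
    run q (w ++ y)             ≡⟨ run-++ q w y ⟩
    run (run q w) y            ≡⟨ cong (λ s → run s y) w-loop ⟩
    run q y                    ∎)) q↦final
    where open ≡-Reasoning

  length≤countUpTo : ∀ {ws} Z → Unique ws → All (λ w → T (accepts w)) ws → All (λ w → length w ≡ Z) ws →
                     length ws ≤ countUpTo D Z
  length≤countUpTo {ws} Z uniq accepted len = begin
    length ws                                         ≤⟨ Unique⇒length≤ uniq ws⊆ ⟩
    length (filter accepts? (wordsOfLength m Z))      ≤⟨ ∈⇒≤sum (∈-map⁺ count (∈-upTo⁺ {suc Z} ≤-refl)) ⟩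
    countUpTo D Z                                     ∎
    where
    open ≤-Reasoning
    accepts? = λ (w : Word m) → T? (accepts w)
    count = λ n → length (filter accepts? (wordsOfLength m n))
    ws⊆ : ∀ {w} → w ∈ ws → w ∈ filter accepts? (wordsOfLength m Z)
    ws⊆ w∈ = ∈-filter⁺ accepts? (subst (λ n → _ ∈ wordsOfLength m n) (All.lookup len w∈) (∈-wordsOfLength _))
                        (All.lookup accepted w∈)

  -- The words x w y, with w a product of k blocks each equal to u or v.
  loops⇒2^k≤countUpTo : ∀ {q} x y {u v} → run start x ≡ q → T (final (run q y)) → run q u ≡ q → run q v ≡ q →
                         u ≢ v → length u ≡ length v → ∀ k → 2 ^ k ≤ countUpTo D ((length x + length y) + k * length u)
  loops⇒2^k≤countUpTo {q} x y {u} {v} x↦q q↦final u-loop v-loop u≢v |u|≡|v| k = begin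
    2 ^ k                        ≡⟨ length-blockWords u v k ⟨
    length blocks                ≡⟨ length-map pad blocks ⟨
    length (map pad blocks)      ≤⟨ length≤countUpTo Z (Unique.map⁺ pad-injective (blockWords-unique u v u≢v |u|≡|v| k))
                                     (All.map⁺ (All.map (accepted-through-loop x y x↦q q↦final) blocks-loop))
                                     (All.map⁺ (All.map pad-length blocks-length)) ⟩
    countUpTo D Z                ∎
    where
    open ≤-Reasoning
    Z = (length x + length y) + k * length u
    pad : Word m → Word m
    pad w = x ++ w ++ y
    blocks = blockWords u v k
    blocks-loop : All (λ w → run q w ≡ q) blocks
    blocks-loop = blockWords-All u v (λ _ w → run q w ≡ q) refl
      (λ {_} {w} → loop-++ u w u-loop) (λ {_} {w} → loop-++ v w v-loop) k
    blocks-length : All (λ w → length w ≡ k * length u) blocks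
    blocks-length = blockWords-All u v (λ j w → length w ≡ j * length u) refl
      (λ {_} {w} |w| → trans (length-++ u) (cong (length u +_) |w|))
      (λ {_} {w} |w| → trans (length-++ v) (cong₂ _+_ (sym |u|≡|v|) |w|)) k
    pad-length : ∀ {w} → length w ≡ k * length u → length (pad w) ≡ Z
    pad-length {w} |w| = trans (length-++ x) (trans (cong (length x +_) (trans (length-++ w) (cong (_+ length y) |w|)))
      (solve 3 (λ p n r → p :+ (n :+ r) := (p :+ r) :+ n) refl (length x) (k * length u) (length y)))
    pad-injective : ∀ {w w′} → pad w ≡ pad w′ → w ≡ w′
    pad-injective {w} {w′} eq = ++-cancelʳ y w w′ (++-cancelˡ x (w ++ y) (w′ ++ y) eq)

  Useful : Fin nStates → Set
  Useful q = (Σ (Word m) λ x → run start x ≡ q) × (Σ (Word m) λ y → T (final (run q y)))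

  -- Otherwise uv and vu are distinct loops of equal length, and the count above beats every polynomial.
  loops-commute : ∀ {C d} → (∀ x → countUpTo D x ≤ C * suc x ^ d) →
                  ∀ {q} → Useful q → ∀ {u v} → run q u ≡ q → run q v ≡ q → u ++ v ≡ v ++ u
  loops-commute {C} {d} bound {q} ((x , x↦q) , (y , q↦final)) {u} {v} u-loop v-loop
    with ≡-dec Fin._≟_ (u ++ v) (v ++ u)
  ... | yes comm = comm
  ... | no ¬comm with exp-beats-poly C d (length x + length y) (length (u ++ v))
  ...   | k , poly<2^k = ⊥-elim (<⇒≱ poly<2^k (≤-trans
          (loops⇒2^k≤countUpTo x y x↦q q↦final (loop-++ u v u-loop v-loop) (loop-++ v u v-loop u-loop)
                               ¬comm (length-++-comm u v) k)
          (bound _)))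


module _ {m : ℕ} (D : DFA m) where
  open DFA D

  -- Two of the n + 1 prefixes of length ≤ n reach the same state; cutting out the segment between them
  -- leaves a shorter nonempty loop.
  shorten-loop : ∀ {q} (w : Word m) → run q w ≡ q → nStates < length w →
                 Σ (Word m) λ v → run q v ≡ q × 0 < length v × length v < length w
  shorten-loop {q} w w-loop n<|w| with pigeonhole (n<1+n nStates) (λ i → run q (take (toℕ i) w))
  ... | i , j , i<j , same-state = v , v-loop , 0<|v| , |v|<|w|
    where
    lo = toℕ i
    hi = toℕ j
    hi≤|w| : hi ≤ length w
    hi≤|w| = ≤-trans (≤-pred (toℕ<n j)) (<⇒≤ n<|w|)
    v = take lo w ++ drop hi w
    v-loop : run q v ≡ q
    v-loop = begin
      run q (take lo w ++ drop hi w)        ≡⟨ run-++ D q (take lo w) (drop hi w) ⟩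
      run (run q (take lo w)) (drop hi w)   ≡⟨ cong (λ s → run s (drop hi w)) same-state ⟩
      run (run q (take hi w)) (drop hi w)   ≡⟨ run-++ D q (take hi w) (drop hi w) ⟨
      run q (take hi w ++ drop hi w)        ≡⟨ cong (run q) (take++drop≡id hi w) ⟩
      run q w                               ≡⟨ w-loop ⟩
      q                                     ∎
      where open ≡-Reasoning
    |v| : length v ≡ lo + (length w ∸ hi)
    |v| = trans (length-++ (take lo w))
            (cong₂ _+_ (trans (length-take lo w) (m≤n⇒m⊓n≡m (≤-trans (<⇒≤ i<j) hi≤|w|))) (length-drop hi w))
    0<|v| : 0 < length v
    0<|v| = ≤-trans (m<n⇒0<n∸m (≤-<-trans (≤-pred (toℕ<n j)) n<|w|))
                    (≤-trans (m≤n+m _ lo) (≤-reflexive (sym |v|)))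
    |v|<|w| : length v < length w
    |v|<|w| = begin-strict
      length v               ≡⟨ |v| ⟩
      lo + (length w ∸ hi)   <⟨ +-monoˡ-< (length w ∸ hi) i<j ⟩
      hi + (length w ∸ hi)   ≡⟨ m+[n∸m]≡n hi≤|w| ⟩
      length w               ∎
      where open ≤-Reasoning

  short-loop : ∀ {q} (w : Word m) → run q w ≡ q → 0 < length w →
               Σ (Word m) λ v → run q v ≡ q × 0 < length v × length v ≤ nStates
  short-loop w = go w (<-wellFounded (length w))
    where
    go : ∀ {q} (w : Word m) → Acc _<_ (length w) → run q w ≡ q → 0 < length w →
         Σ (Word m) λ v → run q v ≡ q × 0 < length v × length v ≤ nStates
    go w (acc rec) w-loop 0<|w| with length w ≤? nStates
    ... | yes |w|≤n = w , w-loop , 0<|w| , |w|≤n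
    ... | no  |w|≰n with shorten-loop w w-loop (≰⇒> |w|≰n)
    ...   | v , v-loop , 0<|v| , |v|<|w| = go v (rec |v|<|w|) v-loop 0<|v|

  record ShortestLoop (q : Fin nStates) : Set where
    field
      word    : Word m
      isLoop  : run q word ≡ q
      short   : length word ≤ nStates
      minimal : ∀ w → run q w ≡ q → 0 < length w → 0 < length word × length word ≤ length w

  LoopsAtLeast : Fin nStates → ℕ → Set
  LoopsAtLeast q l = ∀ w → run q w ≡ q → 0 < length w → l ≤ length w

  loopOfLength? : ∀ q l → Dec (Σ (Word m) λ w → length w ≡ l × run q w ≡ q)
  loopOfLength? q l = map′
    (λ some → let w , w∈ , w-loop = find some in w , ∈-wordsOfLength⁻ w w∈ , w-loop)
    (λ { (w , refl , w-loop) → lose (∈-wordsOfLength w) w-loop })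
    (any? (λ w → run q w Fin.≟ q) (wordsOfLength m l))

  searchLoop : ∀ {q} f l → f + l ≡ suc nStates → 0 < l → LoopsAtLeast q l → ShortestLoop q
  searchLoop {q} zero .(suc nStates) refl _ atLeast = record
    { word = [] ; isLoop = refl ; short = z≤n ; minimal = no-nonempty-loop }
    where
    no-nonempty-loop : ∀ w → run q w ≡ q → 0 < length w → 0 < 0 × 0 ≤ length w
    no-nonempty-loop w w-loop 0<|w| with short-loop w w-loop 0<|w|
    ... | v , v-loop , 0<|v| , |v|≤n = ⊥-elim (<⇒≱ (atLeast v v-loop 0<|v|) |v|≤n)
  searchLoop {q} (suc f) l f+l≡ 0<l atLeast with loopOfLength? q l
  ... | yes (w , |w|≡l , w-loop) = record
    { word    = w
    ; isLoop  = w-loop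
    ; short   = subst (_≤ nStates) (sym |w|≡l) (≤-trans (m≤n+m l f) (≤-reflexive (suc-injective f+l≡)))
    ; minimal = λ v v-loop 0<|v| → subst (0 <_) (sym |w|≡l) 0<l , subst (_≤ length v) (sym |w|≡l) (atLeast v v-loop 0<|v|)
    }
  ... | no ¬loop = searchLoop f (suc l) (trans (+-suc f l) f+l≡) z<s atLeast′
    where
    atLeast′ : LoopsAtLeast q (suc l)
    atLeast′ w w-loop 0<|w| = ≤∧≢⇒< (atLeast w w-loop 0<|w|) (λ l≡|w| → ¬loop (w , sym l≡|w| , w-loop))

  shortestLoop : ∀ q → ShortestLoop q
  shortestLoop q = searchLoop nStates 1 (+-comm nStates 1) z<s (λ _ _ 0<|w| → 0<|w|)

  loop : Fin nStates → Word m
  loop q = ShortestLoop.word (shortestLoop q)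

  loop^ʷ-isLoop : ∀ q k → run q (loop q ^ʷ k) ≡ q
  loop^ʷ-isLoop q = loop-^ʷ D (loop q) (ShortestLoop.isLoop (shortestLoop q))


module _ {m : ℕ} (D : DFA m) where
  open DFA D
  open DecMembership (Fin._≟_ {nStates}) using (_∈?_)

  -- w = (loop q)^k₀ a₁ (loop q₁)^k₁ ⋯ aₙ (loop qₙ)^kₙ along the skeleton a₁⋯aₙ from q
  data OnPath : Fin nStates → Word m → Word m → Set where
    end  : ∀ {q} k → OnPath q [] (loop D q ^ʷ k)
    step : ∀ {q a sk w} k → OnPath (δ q a) sk w → OnPath q (a ∷ sk) (loop D q ^ʷ k ++ a ∷ w)

  OnPath-run : ∀ {q sk w} → OnPath q sk w → run q w ≡ run q sk
  OnPath-run {q} (end k) = loop^ʷ-isLoop D q k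
  OnPath-run {q} (step {a = a} {w = w} k path) = trans (run-++ D q (loop D q ^ʷ k) (a ∷ w))
    (trans (cong (λ s → run s (a ∷ w)) (loop^ʷ-isLoop D q k)) (OnPath-run path))

  visits : Fin nStates → Word m → List (Fin nStates)
  visits q []      = q ∷ []
  visits q (a ∷ w) = q ∷ visits (δ q a) w

  visits-head : ∀ q w → q ∈ visits q w
  visits-head q []      = here refl
  visits-head q (a ∷ w) = here refl

  visits-++ : ∀ q u v → visits (run q u) v ⊆ visits q (u ++ v)
  visits-++ q []      v s∈ = s∈
  visits-++ q (a ∷ u) v s∈ = there (visits-++ (δ q a) u v s∈)

  length-visits : ∀ q w → length (visits q w) ≡ suc (length w)
  length-visits q []      = refl
  length-visits q (a ∷ w) = cong suc (length-visits (δ q a) w)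

  NoReturn : Fin nStates → Word m → Set
  NoReturn q []      = ⊤
  NoReturn q (a ∷ r) = q ∉ visits (δ q a) r

  last-visit : ∀ q s w → q ∈ visits s w →
               Σ (Word m) λ ℓ → Σ (Word m) λ r → w ≡ ℓ ++ r × run s ℓ ≡ q × NoReturn q r
  last-visit q s [] (here refl) = [] , [] , refl , refl , tt
  last-visit q s (a ∷ w) q∈ with q ∈? visits (δ s a) w
  ... | yes q∈′ with last-visit q (δ s a) w q∈′
  ...   | ℓ , r , w≡ , ℓ↦q , noReturn = a ∷ ℓ , r , cong (a ∷_) w≡ , ℓ↦q , noReturn
  last-visit q s (a ∷ w) (here refl) | no q∉ = [] , a ∷ w , refl , refl , q∉
  last-visit q s (a ∷ w) (there q∈)  | no q∉ = ⊥-elim (q∉ q∈)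

  module _ {C d} (bound : ∀ x → countUpTo D x ≤ C * suc x ^ d) where

    module _ {q} (useful : Useful D q) where
      open ShortestLoop (shortestLoop D q)

      -- w commutes with the shortest loop p and |p| ≤ |w|, so p is a prefix of w.
      peel-loop : ∀ w → run q w ≡ q → 0 < length w →
                  Σ (Word m) λ w′ → w ≡ word ++ w′ × run q w′ ≡ q × length w′ < length w
      peel-loop w w-loop 0<|w| = w′ , w≡ , w′-loop , |w′|<|w|
        where
        0<|p| = proj₁ (minimal w w-loop 0<|w|)
        |p|≤|w| = proj₂ (minimal w w-loop 0<|w|)
        w′ = drop (length word) w
        w≡ : w ≡ word ++ w′
        w≡ = commute⇒prefix word w (loops-commute D {C} {d} bound useful {word} {w} isLoop w-loop) |p|≤|w|
        |w′|<|w| : length w′ < length w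
        |w′|<|w| = subst (_< length w) (sym (length-drop (length word) w)) (∸-monoʳ-< 0<|p| |p|≤|w|)
        w′-loop : run q w′ ≡ q
        w′-loop = trans (cong (λ s → run s w′) (sym isLoop))
                        (trans (sym (run-++ D q word w′)) (trans (cong (run q) (sym w≡)) w-loop))

      loop-power : ∀ w → run q w ≡ q → Σ ℕ λ k → w ≡ word ^ʷ k
      loop-power w = go w (<-wellFounded (length w))
        where
        go : ∀ w → Acc _<_ (length w) → run q w ≡ q → Σ ℕ λ k → w ≡ word ^ʷ k
        go []          _         _      = 0 , refl
        go w@(_ ∷ _) (acc rec) w-loop with peel-loop w w-loop z<s
        ... | w′ , w≡ , w′-loop , shorter with go w′ (rec shorter) w′-loop
        ...   | k , w′≡ = suc k , trans w≡ (cong (word ++_) w′≡)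

    Skeleton : Fin nStates → Word m → Set
    Skeleton q w = Σ (Word m) λ sk → OnPath q sk w × Unique (visits q sk) × visits q sk ⊆ visits q w

    -- Cut w after its last visit to q: the part before is a loop at q, hence a power of loop q, and the
    -- rest never returns to q, so q does not recur in the skeleton of the rest.
    skeleton : ∀ {q} x w → run start x ≡ q → T (final (run q w)) → Skeleton q w
    skeleton x w = go x w (<-wellFounded (length w))
      where
      go : ∀ {q} x w → Acc _<_ (length w) → run start x ≡ q → T (final (run q w)) → Skeleton q w
      go {q} x w (acc rec) x↦q w-final with last-visit q q w (visits-head q w)
      ... | ℓ , r , w≡ℓr , ℓ-loop , noReturn with loop-power ((x , x↦q) , (w , w-final)) ℓ ℓ-loop
      ...   | k , ℓ≡ = rest r w≡ℓr noReturn
        where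
        rest : ∀ r → w ≡ ℓ ++ r → NoReturn q r → Skeleton q w
        rest [] w≡ℓ _ = [] , subst (OnPath q []) (sym w≡) (end k) , [] ∷ [] , λ { (here refl) → visits-head q w }
          where
          w≡ : w ≡ loop D q ^ʷ k
          w≡ = trans w≡ℓ (trans (++-identityʳ ℓ) ℓ≡)
        rest (a ∷ r′) w≡ℓar′ q∉ with go (x ++ ℓ ++ a ∷ []) r′ (rec shorter) x′↦δqa r′-final
          where
          shorter : length r′ < length w
          shorter = subst (length r′ <_) (sym (trans (cong length w≡ℓar′) (length-++ ℓ)))
                          (≤-trans (n<1+n (length r′)) (m≤n+m (suc (length r′)) (length ℓ)))
          w↦ : run q w ≡ run (δ q a) r′
          w↦ = trans (cong (run q) w≡ℓar′) (trans (run-++ D q ℓ (a ∷ r′)) (cong (λ s → run s (a ∷ r′)) ℓ-loop))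
          x′↦δqa : run start (x ++ ℓ ++ a ∷ []) ≡ δ q a
          x′↦δqa = trans (run-++ D start x (ℓ ++ a ∷ []))
                     (trans (cong (λ s → run s (ℓ ++ a ∷ [])) x↦q)
                       (trans (run-++ D q ℓ (a ∷ [])) (cong (λ s → δ s a) ℓ-loop)))
          r′-final : T (final (run (δ q a) r′))
          r′-final = subst (λ s → T (final s)) w↦ w-final
        ... | sk , path , unique , sk⊆r′ = a ∷ sk , subst (OnPath q (a ∷ sk)) (sym w≡) (step k path) ,
                                             ¬Any⇒All¬ _ (λ q∈ → q∉ (sk⊆r′ q∈)) ∷ unique , sk⊆w
          where
          w≡ : w ≡ loop D q ^ʷ k ++ a ∷ r′
          w≡ = trans w≡ℓar′ (cong (_++ a ∷ r′) ℓ≡)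
          sk⊆w : visits q (a ∷ sk) ⊆ visits q w
          sk⊆w (here refl) = visits-head q w
          sk⊆w (there s∈)  = subst (λ v → _ ∈ visits q v) (sym w≡ℓar′)
            (visits-++ q ℓ (a ∷ r′) (subst (λ p → _ ∈ visits p (a ∷ r′)) (sym ℓ-loop) (there (sk⊆r′ s∈))))

    short-skeleton : ∀ w → T (accepts w) → Σ (Word m) λ sk → OnPath start sk w × length sk < nStates
    short-skeleton w accepted with skeleton [] w refl accepted
    ... | sk , path , unique , _ = sk , path , (begin
      suc (length sk)             ≡⟨ length-visits start sk ⟨
      length (visits start sk)    ≤⟨ Unique⇒length≤ unique (λ {s} _ → ∈-allFin s) ⟩
      length (allFin nStates)     ≡⟨ length-tabulate (λ i → i) ⟩
      nStates                     ∎)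
      where open ≤-Reasoning hiding (start)


data Item (A : Set) : Set where
  fixed : List A → Item A
  star  : List A → Item A

Pattern : Set → Set
Pattern A = List (Item A)

module _ {A : Set} where

  stars : Pattern A → ℕ
  stars []            = 0
  stars (fixed _ ∷ P) = stars P
  stars (star _ ∷ P)  = suc (stars P)

  instantiate : (P : Pattern A) → Vec ℕ (stars P) → List A
  instantiate []            []       = []
  instantiate (fixed u ∷ P) ks       = u ++ instantiate P ks
  instantiate (star u ∷ P)  (k ∷ ks) = u ^ʷ k ++ instantiate P ks

  infix 4 _∈ᴾ_
  _∈ᴾ_ : List A → Pattern A → Set
  w ∈ᴾ P = Σ (Vec ℕ (stars P)) λ ks → w ≡ instantiate P ks

  StarOfLength : ℕ → Item A → Set
  StarOfLength N (fixed _) = ⊤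
  StarOfLength N (star u)  = length u ≡ N

  module _ (N : ℕ) .{{_ : NonZero N}} where

    -- The powers of p: writing k = ρ + t·c with c = N / |p| and ρ < c gives p^k = p^ρ (p^c)^t.
    loopPatterns : List A → Pattern A → List (Pattern A)
    loopPatterns []         P = P ∷ []
    loopPatterns p@(_ ∷ _) P = map (λ ρ → fixed (p ^ʷ ρ) ∷ star (p ^ʷ (N / length p)) ∷ P) (upTo (N / length p))

    ∈-loopPatterns⁺ : ∀ p {P w} → (0 < length p → length p ∣ N) → w ∈ᴾ P → ∀ k → Any (p ^ʷ k ++ w ∈ᴾ_) (loopPatterns p P)
    ∈-loopPatterns⁺ []         _      (ks , w≡) k = here (ks , trans (cong (_++ _) ([]^ʷ k)) w≡)
    ∈-loopPatterns⁺ p@(_ ∷ _) {P} {w} period (ks , w≡) k =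
      Any.map⁺ (lose (∈-upTo⁺ (m%n<n k c)) (k / c ∷ ks , (begin
        p ^ʷ k ++ w                                   ≡⟨ cong (λ j → p ^ʷ j ++ w) (m≡m%n+[m/n]*n k c) ⟩
        p ^ʷ (k % c + k / c * c) ++ w                 ≡⟨ cong (_++ w) (^ʷ-+ p (k % c) (k / c * c)) ⟩
        (p ^ʷ (k % c) ++ p ^ʷ (k / c * c)) ++ w       ≡⟨ ++-assoc (p ^ʷ (k % c)) _ w ⟩
        p ^ʷ (k % c) ++ p ^ʷ (k / c * c) ++ w         ≡⟨ cong (λ u → p ^ʷ (k % c) ++ u ++ w) (^ʷ-* p (k / c) c) ⟩
        p ^ʷ (k % c) ++ (p ^ʷ c) ^ʷ (k / c) ++ w      ≡⟨ cong (λ u → p ^ʷ (k % c) ++ (p ^ʷ c) ^ʷ (k / c) ++ u) w≡ ⟩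
        instantiate (fixed (p ^ʷ (k % c)) ∷ star (p ^ʷ c) ∷ P) (k / c ∷ ks) ∎)))
      where
      open ≡-Reasoning
      c = N / length p
      instance
        _ : NonZero c
        _ = >-nonZero (m≥n⇒m/n>0 (∣⇒≤ (period z<s)))

    ∈-loopPatterns⁻ : ∀ p {P v} → Any (v ∈ᴾ_) (loopPatterns p P) →
                      Σ ℕ λ k → Σ (List A) λ w → v ≡ p ^ʷ k ++ w × w ∈ᴾ P
    ∈-loopPatterns⁻ []         (here v∈P) = 0 , _ , refl , v∈P
    ∈-loopPatterns⁻ p@(_ ∷ _) {P} {v} v∈ with Any.satisfied (Any.map⁻ v∈)
    ... | ρ , t ∷ ks , v≡ = ρ + t * c , instantiate P ks , (begin
      v                                          ≡⟨ v≡ ⟩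
      p ^ʷ ρ ++ (p ^ʷ c) ^ʷ t ++ instantiate P ks ≡⟨ cong (λ u → p ^ʷ ρ ++ u ++ instantiate P ks) (^ʷ-* p t c) ⟨
      p ^ʷ ρ ++ p ^ʷ (t * c) ++ instantiate P ks  ≡⟨ ++-assoc (p ^ʷ ρ) _ _ ⟨
      (p ^ʷ ρ ++ p ^ʷ (t * c)) ++ instantiate P ks ≡⟨ cong (_++ instantiate P ks) (^ʷ-+ p ρ (t * c)) ⟨
      p ^ʷ (ρ + t * c) ++ instantiate P ks        ∎) , ks , refl
      where
      open ≡-Reasoning
      c = N / length p

    loopPatterns-stars : ∀ p {P} → (0 < length p → length p ∣ N) → All (StarOfLength N) P →
                         All (All (StarOfLength N)) (loopPatterns p P)
    loopPatterns-stars []         _      P-stars = P-stars ∷ []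
    loopPatterns-stars p@(_ ∷ _) period P-stars =
      All.map⁺ (All.tabulate (λ _ → tt ∷ trans (length-^ʷ p (N / length p)) (m/n*n≡m (period z<s)) ∷ P-stars))


module _ {m : ℕ} (D : DFA m) (N : ℕ) .{{_ : NonZero N}} where
  open DFA D

  stepPatterns : Fin nStates → Fin m → Pattern (Fin m) → List (Pattern (Fin m))
  stepPatterns q a P = loopPatterns N (loop D q) (fixed (a ∷ []) ∷ P)

  pathPatterns : Fin nStates → Word m → List (Pattern (Fin m))
  pathPatterns q []       = loopPatterns N (loop D q) []
  pathPatterns q (a ∷ sk) = concatMap (stepPatterns q a) (pathPatterns (δ q a) sk)

  module _ (n!∣N : nStates ! ∣ N) where

    loop-period : ∀ q → 0 < length (loop D q) → length (loop D q) ∣ N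
    loop-period q 0<|p| = ∣-trans (m≤n⇒m∣n! 0<|p| (ShortestLoop.short (shortestLoop D q))) n!∣N

    OnPath⇒pathPatterns : ∀ {q sk w} → OnPath D q sk w → Any (w ∈ᴾ_) (pathPatterns q sk)
    OnPath⇒pathPatterns {q} (end k) =
      subst (λ w → Any (w ∈ᴾ_) (pathPatterns q [])) (++-identityʳ (loop D q ^ʷ k))
            (∈-loopPatterns⁺ N (loop D q) (loop-period q) ([] , refl) k)
    OnPath⇒pathPatterns {q} (step {a = a} k path) = Any.concatMap⁺ (stepPatterns q a) (Any.map
      (λ { (ks , w≡) → ∈-loopPatterns⁺ N (loop D q) (loop-period q) (ks , cong (a ∷_) w≡) k })
      (OnPath⇒pathPatterns path))

    pathPatterns⇒OnPath : ∀ q sk {w} → Any (w ∈ᴾ_) (pathPatterns q sk) → OnPath D q sk w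
    pathPatterns⇒OnPath q [] w∈ with ∈-loopPatterns⁻ N (loop D q) w∈
    ... | k , v , w≡ , [] , refl = subst (OnPath D q []) (sym (trans w≡ (++-identityʳ _))) (end k)
    pathPatterns⇒OnPath q (a ∷ sk) w∈ with find (Any.concatMap⁻ (stepPatterns q a) w∈)
    ... | P , P∈ , w∈′ with ∈-loopPatterns⁻ N (loop D q) w∈′
    ...   | k , v , w≡ , ks , refl =
      subst (OnPath D q (a ∷ sk)) (sym w≡) (step k (pathPatterns⇒OnPath (δ q a) sk (lose P∈ (ks , refl))))

    pathPatterns-stars : ∀ q sk → All (All (StarOfLength N)) (pathPatterns q sk)
    pathPatterns-stars q []       = loopPatterns-stars N (loop D q) (loop-period q) []
    pathPatterns-stars q (a ∷ sk) = All.concat⁺ (All.map⁺ (All.map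
      (loopPatterns-stars N (loop D q) (loop-period q) ∘ (tt ∷_)) (pathPatterns-stars (δ q a) sk)))

-- Every accepted word runs along a skeleton of fewer than n letters, so finitely many skeletons suffice.
sparse⇒patterns : ∀ {m C d} (D : DFA m) → (∀ x → countUpTo D x ≤ C * suc x ^ d) →
                  ∀ N .{{_ : NonZero N}} → DFA.nStates D ! ∣ N →
                  Σ (List (Pattern (Fin m))) λ Ps → All (All (StarOfLength N)) Ps ×
                    (∀ w → T (DFA.accepts D w) ⇔ Any (w ∈ᴾ_) Ps)
sparse⇒patterns {m} {C} {d} D bound N n!∣N =
  concatMap (pathPatterns D N start) skeletons ,
  All.concat⁺ (All.map⁺ {xs = skeletons} (All.tabulate (λ {sk} _ → pathPatterns-stars D N n!∣N start sk))) ,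
  λ w → mk⇔ (accepted⇒ w) (⇒accepted w)
  where
  open DFA D
  accepts? = λ (w : Word m) → T? (accepts w)
  skeletons = filter accepts? (concatMap (wordsOfLength m) (upTo nStates))
  accepted-along : ∀ {sk w} → OnPath D start sk w → T (accepts sk) → T (accepts w)
  accepted-along path = subst (λ s → T (final s)) (sym (OnPath-run D path))
  accepted⇒ : ∀ w → T (accepts w) → Any (w ∈ᴾ_) (concatMap (pathPatterns D N start) skeletons)
  accepted⇒ w w-accepted with short-skeleton D {C} {d} bound w w-accepted
  ... | sk , path , |sk|<n =
    Any.concatMap⁺ (pathPatterns D N start) {xs = skeletons} (lose sk∈ (OnPath⇒pathPatterns D N n!∣N path))
    where
    sk∈ = ∈-filter⁺ accepts? (∈-concatMap⁺ (wordsOfLength m) (lose (∈-upTo⁺ |sk|<n) (∈-wordsOfLength sk)))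
            (subst (λ s → T (final s)) (OnPath-run D path) w-accepted)
  ⇒accepted : ∀ w → Any (w ∈ᴾ_) (concatMap (pathPatterns D N start) skeletons) → T (accepts w)
  ⇒accepted w w∈ with find (Any.concatMap⁻ (pathPatterns D N start) {xs = skeletons} w∈)
  ... | sk , sk∈ , w∈′ with ∈-filter⁻ accepts? {xs = concatMap (wordsOfLength m) (upTo nStates)} sk∈
  ...   | _ , sk-accepted = accepted-along (pathPatterns⇒OnPath D N n!∣N start sk w∈′) sk-accepted


module _ {a} {X : Set a} where

  iter-+ : ∀ (f : X → X) i j x → iter f (i + j) x ≡ iter f i (iter f j x)
  iter-+ f zero    j x = refl
  iter-+ f (suc i) j x = cong f (iter-+ f i j x)

  iter-* : ∀ (f : X → X) i j x → iter f (i * j) x ≡ iter (iter f j) i x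
  iter-* f zero    j x = refl
  iter-* f (suc i) j x = trans (iter-+ f j (i * j) x) (cong (iter f j) (iter-* f i j x))

  iter-comm : ∀ (f : X → X) i j x → iter f i (iter f j x) ≡ iter f j (iter f i x)
  iter-comm f i j x = trans (sym (iter-+ f i j x)) (trans (cong (λ n → iter f n x) (+-comm i j)) (iter-+ f j i x))

  length-rep : ∀ k (x : X) → length (rep k x) ≡ k
  length-rep zero    x = refl
  length-rep (suc k) x = cong suc (length-rep k x)

  powWord-map : ∀ (f : X → X) {n} (ks : Vec ℕ n) xs → powWord ks (Vec.map f xs) ≡ map f (powWord ks xs)
  powWord-map f []       []       = refl
  powWord-map f (k ∷ ks) (x ∷ xs) = trans (cong₂ _++_ (rep-map k) (powWord-map f ks xs)) (sym (map-++ f (rep k x) _))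
    where
    rep-map : ∀ k → rep k (f x) ≡ map f (rep k x)
    rep-map zero    = refl
    rep-map (suc k) = cong (f x ∷_) (rep-map k)

module _ {c ℓ} (Γ : AbelianGroup c ℓ) where
  open AbelianGroup Γ renaming (Carrier to G₀; refl to ≈-refl; sym to ≈-sym; trans to ≈-trans)
  open MonoidMorphisms rawMonoid rawMonoid using (IsMonoidHomomorphism)
  open IsMonoidHomomorphism using (⟦⟧-cong; homo; ε-homo)
  open import Relation.Binary.Reasoning.Setoid (AbelianGroup.setoid Γ)
  open import Algebra.Properties.CommutativeSemigroup commutativeSemigroup using (x∙yz≈y∙xz)

  iter-homo : ∀ {H} → IsMonoidHomomorphism H → ∀ k → IsMonoidHomomorphism (iter H k)
  iter-homo H-homo zero    = Identity.isMonoidHomomorphism rawMonoid ≈-refl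
  iter-homo H-homo (suc k) = Composition.isMonoidHomomorphism ≈-trans (iter-homo H-homo k) H-homo

  eval-≗ : ∀ {G G′ : G₀ → G₀} → (∀ x → G x ≡ G′ x) → ∀ xs → eval Γ G xs ≡ eval Γ G′ xs
  eval-≗ G≗G′ []       = refl
  eval-≗ {G′ = G′} G≗G′ (x ∷ xs) = cong (x ∙_) (trans (G≗G′ _) (cong G′ (eval-≗ G≗G′ xs)))

  module _ {G} (G-homo : IsMonoidHomomorphism G) where

    eval-++ : ∀ xs ys → eval Γ G (xs ++ ys) ≈ eval Γ G xs ∙ iter G (length xs) (eval Γ G ys)
    eval-++ []       ys = ≈-sym (identityˡ _)
    eval-++ (x ∷ xs) ys = begin
      x ∙ G (eval Γ G (xs ++ ys))                                ≈⟨ ∙-congˡ (⟦⟧-cong G-homo (eval-++ xs ys)) ⟩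
      x ∙ G (eval Γ G xs ∙ iter G (length xs) (eval Γ G ys))     ≈⟨ ∙-congˡ (homo G-homo _ _) ⟩
      x ∙ (G (eval Γ G xs) ∙ iter G (suc (length xs)) (eval Γ G ys)) ≈⟨ assoc _ _ _ ⟨
      (x ∙ G (eval Γ G xs)) ∙ iter G (suc (length xs)) (eval Γ G ys) ∎

    eval-map : ∀ {ψ} → IsMonoidHomomorphism ψ → (∀ x → ψ (G x) ≡ G (ψ x)) →
               ∀ xs → ψ (eval Γ G xs) ≈ eval Γ G (map ψ xs)
    eval-map ψ-homo ψG≡Gψ []       = ε-homo ψ-homo
    eval-map {ψ} ψ-homo ψG≡Gψ (x ∷ xs) = begin
      ψ (x ∙ G (eval Γ G xs))         ≈⟨ homo ψ-homo _ _ ⟩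
      ψ x ∙ ψ (G (eval Γ G xs))       ≡⟨ cong (ψ x ∙_) (ψG≡Gψ _) ⟩
      ψ x ∙ G (ψ (eval Γ G xs))       ≈⟨ ∙-congˡ (⟦⟧-cong G-homo (eval-map ψ-homo ψG≡Gψ xs)) ⟩
      ψ x ∙ G (eval Γ G (map ψ xs))   ∎

    -- [aᵏ]_G + Gᵏ t = t + [bᵏ]_G with b = a + G t − t: each term G^i t cancels against the next.
    telescope : ∀ k a t → eval Γ G (rep k a) ∙ iter G k t ≈ t ∙ eval Γ G (rep k ((a ∙ G t) ∙ t ⁻¹))
    telescope zero    a t = ≈-trans (identityˡ t) (≈-sym (identityʳ t))
    telescope (suc k) a t = begin
      (a ∙ G R) ∙ G Gᵏt       ≈⟨ assoc _ _ _ ⟩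
      a ∙ (G R ∙ G Gᵏt)       ≈⟨ ∙-congˡ (homo G-homo _ _) ⟨
      a ∙ G (R ∙ Gᵏt)       ≈⟨ ∙-congˡ (⟦⟧-cong G-homo (telescope k a t)) ⟩
      a ∙ G (t ∙ S)          ≈⟨ ∙-congˡ (homo G-homo _ _) ⟩
      a ∙ (G t ∙ G S)        ≈⟨ assoc _ _ _ ⟨
      (a ∙ G t) ∙ G S        ≈⟨ ∙-congʳ b+t≈ ⟨
      (t ∙ b) ∙ G S          ≈⟨ assoc _ _ _ ⟩
      t ∙ (b ∙ G S)          ∎
      where
      b = (a ∙ G t) ∙ t ⁻¹
      R = eval Γ G (rep k a)
      Gᵏt = iter G k t
      S = eval Γ G (rep k b)
      b+t≈ : t ∙ b ≈ a ∙ G t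
      b+t≈ = ≈-trans (x∙yz≈y∙xz t (a ∙ G t) (t ⁻¹)) (≈-trans (∙-congˡ (inverseʳ t)) (identityʳ _))

  module _ {H} (H-homo : IsMonoidHomomorphism H) (N : ℕ) {A : Set} (e : A → G₀) where

    G : G₀ → G₀
    G = iter H N

    G-homo : IsMonoidHomomorphism G
    G-homo = iter-homo H-homo N

    ev : List A → G₀
    ev w = eval Γ H (map e w)

    ev-++ : ∀ u w → ev (u ++ w) ≈ ev u ∙ iter H (length u) (ev w)
    ev-++ u w = begin
      eval Γ H (map e (u ++ w))                                  ≡⟨ cong (eval Γ H) (map-++ e u w) ⟩
      eval Γ H (map e u ++ map e w)                              ≈⟨ eval-++ H-homo (map e u) (map e w) ⟩
      ev u ∙ iter H (length (map e u)) (ev w)                    ≡⟨ cong (λ n → ev u ∙ iter H n (ev w)) (length-map e u) ⟩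
      ev u ∙ iter H (length u) (ev w)                            ∎

    ev-^ʷ : ∀ u → length u ≡ N → ∀ k → ev (u ^ʷ k) ≈ eval Γ G (rep k (ev u))
    ev-^ʷ u |u|≡N zero    = ≈-refl
    ev-^ʷ u |u|≡N (suc k) = begin
      ev (u ++ u ^ʷ k)                       ≈⟨ ev-++ u (u ^ʷ k) ⟩
      ev u ∙ iter H (length u) (ev (u ^ʷ k)) ≡⟨ cong (λ n → ev u ∙ iter H n (ev (u ^ʷ k))) |u|≡N ⟩
      ev u ∙ G (ev (u ^ʷ k))                 ≈⟨ ∙-congˡ (⟦⟧-cong G-homo (ev-^ʷ u |u|≡N k)) ⟩
      ev u ∙ G (eval Γ G (rep k (ev u)))     ∎

    shift : Pattern A → G₀
    shift []            = ε
    shift (fixed u ∷ P) = ev u ∙ iter H (length u) (shift P)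
    shift (star u ∷ P)  = shift P

    generators : (P : Pattern A) → Vec G₀ (stars P)
    generators []            = []
    generators (fixed u ∷ P) = Vec.map (iter H (length u)) (generators P)
    generators (star u ∷ P)  = (ev u ∙ G (shift P)) ∙ shift P ⁻¹ ∷ generators P

    ev-instantiate : ∀ {P} → All (StarOfLength N) P → ∀ ks →
                     ev (instantiate P ks) ≈ shift P ∙ eval Γ G (powWord ks (generators P))
    ev-instantiate {[]}          []              [] = ≈-sym (identityʳ ε)
    ev-instantiate {fixed u ∷ P} (_ ∷ P-stars)   ks = begin
      ev (u ++ instantiate P ks)           ≈⟨ ev-++ u (instantiate P ks) ⟩
      ev u ∙ Hʲ (ev (instantiate P ks))    ≈⟨ ∙-congˡ (⟦⟧-cong Hʲ-homo (ev-instantiate P-stars ks)) ⟩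
      ev u ∙ Hʲ (t ∙ eval Γ G gs)          ≈⟨ ∙-congˡ (homo Hʲ-homo _ _) ⟩
      ev u ∙ (Hʲ t ∙ Hʲ (eval Γ G gs))     ≈⟨ ∙-congˡ (∙-congˡ (eval-map G-homo Hʲ-homo (λ x → iter-comm H j N x) gs)) ⟩
      ev u ∙ (Hʲ t ∙ eval Γ G (map Hʲ gs)) ≡⟨ cong (λ v → ev u ∙ (Hʲ t ∙ eval Γ G v)) (powWord-map Hʲ ks (generators P)) ⟨
      ev u ∙ (Hʲ t ∙ eval Γ G (powWord ks (Vec.map Hʲ (generators P)))) ≈⟨ assoc _ _ _ ⟨
      (ev u ∙ Hʲ t) ∙ eval Γ G (powWord ks (Vec.map Hʲ (generators P))) ∎
      where
      j = length u
      Hʲ = iter H j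
      Hʲ-homo = iter-homo H-homo j
      t = shift P
      gs = powWord ks (generators P)
    ev-instantiate {star u ∷ P}  (|u|≡N ∷ P-stars) (k ∷ ks) = begin
      ev (u ^ʷ k ++ instantiate P ks)                        ≈⟨ ev-++ (u ^ʷ k) (instantiate P ks) ⟩
      ev (u ^ʷ k) ∙ iter H (length (u ^ʷ k)) (ev (instantiate P ks)) ≡⟨ cong (ev (u ^ʷ k) ∙_) Hᵏᴺ≡Gᵏ ⟩
      ev (u ^ʷ k) ∙ Gᵏ (ev (instantiate P ks))               ≈⟨ ∙-cong (ev-^ʷ u |u|≡N k)
                                                                        (⟦⟧-cong Gᵏ-homo (ev-instantiate P-stars ks)) ⟩
      eval Γ G (rep k (ev u)) ∙ Gᵏ (t ∙ E)                   ≈⟨ ∙-congˡ (homo Gᵏ-homo _ _) ⟩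
      eval Γ G (rep k (ev u)) ∙ (Gᵏ t ∙ Gᵏ E)                ≈⟨ assoc _ _ _ ⟨
      (eval Γ G (rep k (ev u)) ∙ Gᵏ t) ∙ Gᵏ E                ≈⟨ ∙-congʳ (telescope G-homo k (ev u) t) ⟩
      (t ∙ eval Γ G (rep k b)) ∙ Gᵏ E                        ≈⟨ assoc _ _ _ ⟩
      t ∙ (eval Γ G (rep k b) ∙ Gᵏ E)                        ≡⟨ cong (λ n → t ∙ (eval Γ G (rep k b) ∙ iter G n E))
                                                                     (length-rep k b) ⟨
      t ∙ (eval Γ G (rep k b) ∙ iter G (length (rep k b)) E) ≈⟨ ∙-congˡ (eval-++ G-homo (rep k b) (powWord ks (generators P))) ⟨
      t ∙ eval Γ G (rep k b ++ powWord ks (generators P))    ∎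
      where
      t = shift P
      b = (ev u ∙ G t) ∙ t ⁻¹
      E = eval Γ G (powWord ks (generators P))
      Gᵏ = iter G k
      Gᵏ-homo = iter-homo G-homo k
      Hᵏᴺ≡Gᵏ : iter H (length (u ^ʷ k)) (ev (instantiate P ks)) ≡ Gᵏ (ev (instantiate P ks))
      Hᵏᴺ≡Gᵏ = trans (cong (λ n → iter H n (ev (instantiate P ks)))
                         (trans (length-^ʷ u k) (cong (k *_) |u|≡N)))
                       (iter-* H k N _)

    toPiece : Pattern A → Piece Γ
    toPiece P = piece (shift P) (stars P) (generators P)

    patterns⇒starTranslates : ∀ {b} {B : G₀ → Set b} (Ps : List (Pattern A)) → All (All (StarOfLength N)) Ps →
                              (∀ g → B g ⇔ (Σ (List A) λ w → Any (w ∈ᴾ_) Ps × ev w ≈ g)) →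
                              FiniteUnionOfStarTranslates Γ G B
    patterns⇒starTranslates {B = B} Ps Ps-stars B⇔ = map toPiece Ps , λ g → mk⇔ (to g) (from g)
      where
      to : ∀ g → B g → Any (λ p → InPiece Γ G p g) (map toPiece Ps)
      to g Bg with Equivalence.to (B⇔ g) Bg
      ... | w , w∈ , w↦g with find w∈
      ...   | P , P∈ , ks , w≡ = lose (∈-map⁺ toPiece P∈) (ks , (begin
        g                                                ≈⟨ w↦g ⟨
        ev w                                             ≡⟨ cong ev w≡ ⟩
        ev (instantiate P ks)                            ≈⟨ ev-instantiate (All.lookup Ps-stars P∈) ks ⟩
        shift P ∙ eval Γ G (powWord ks (generators P))   ∎))
      from : ∀ g → Any (λ p → InPiece Γ G p g) (map toPiece Ps) → B g
      from g g∈ with find (Any.map⁻ g∈)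
      ... | P , P∈ , ks , g≈ = Equivalence.from (B⇔ g)
        (instantiate P ks , lose P∈ (ks , refl) , ≈-trans (ev-instantiate (All.lookup Ps-stars P∈) ks) (≈-sym g≈))

  InPiece-≗ : ∀ {G G′ : G₀ → G₀} → (∀ x → G x ≡ G′ x) → ∀ {p g} → InPiece Γ G p g → InPiece Γ G′ p g
  InPiece-≗ G≗G′ {piece t n as} (ks , g≈) = ks , ≈-trans g≈ (reflexive (cong (t ∙_) (eval-≗ G≗G′ (powWord ks as))))

  starTranslates-≗ : ∀ {b} {B : G₀ → Set b} {G G′ : G₀ → G₀} → (∀ x → G x ≡ G′ x) →
                     FiniteUnionOfStarTranslates Γ G B → FiniteUnionOfStarTranslates Γ G′ B
  starTranslates-≗ G≗G′ (ps , B⇔) = ps , λ g → mk⇔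
    (Any.map (InPiece-≗ G≗G′) ∘ Equivalence.to (B⇔ g))
    (Equivalence.from (B⇔ g) ∘ Any.map (InPiece-≗ (sym ∘ G≗G′)))

cofactor : ∀ {s} a r .{{_ : NonZero s}} → a * r ∣ s → Σ ℕ λ N → NonZero N × a ∣ N × s ≡ N * r
cofactor {s} a r (divides q s≡) =
  q * a , ≢-nonZero (λ N≡0 → ≢-nonZero⁻¹ s (trans s≡N*r (cong (_* r) N≡0))) , n∣m*n q , s≡N*r
  where
  s≡N*r : s ≡ q * a * r
  s≡N*r = trans s≡ (sym (*-assoc q a r))

proposition5p3 : {c ℓ a : Level} (Γ : AbelianGroup c ℓ) (F : AbelianGroup.Carrier Γ → AbelianGroup.Carrier Γ)
    (A : AbelianGroup.Carrier Γ → Set a) →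
    Infinite Γ → InjectiveEndo Γ F → FSparse Γ F A →
    Σ ℕ λ s₀ → 0 < s₀ ×
      ((s : ℕ) → 0 < s → s₀ ∣ s → FiniteUnionOfStarTranslates Γ (iter F s) A)
proposition5p3 Γ F A _ F-mono (r , 0<r , m , e , _ , L , (D , D-recognises-L , C , d , bound) , A⇔) =
  DFA.nStates D ! * r , *-mono-≤ (1≤n! (DFA.nStates D)) 0<r , starTranslates
  where
  open GroupMorphisms (AbelianGroup.rawGroup Γ) (AbelianGroup.rawGroup Γ) using (module IsGroupMonomorphism)
  H-homo = iter-homo Γ (IsGroupMonomorphism.isMonoidHomomorphism F-mono) r
  starTranslates : (s : ℕ) → 0 < s → DFA.nStates D ! * r ∣ s → FiniteUnionOfStarTranslates Γ (iter F s) A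
  starTranslates s 0<s s₀∣s with cofactor (DFA.nStates D !) r {{>-nonZero 0<s}} s₀∣s
  ... | N , N≢0 , n!∣N , s≡N*r with sparse⇒patterns {C = C} {d} D bound N {{N≢0}} n!∣N
  ...   | Ps , Ps-stars , accepts⇔ =
    starTranslates-≗ Γ (λ x → sym (trans (cong (λ n → iter F n x) s≡N*r) (iter-* F N r x)))
      (patterns⇒starTranslates Γ H-homo N e Ps Ps-stars λ g →
        ⇔.trans (A⇔ g) (mk⇔ (map₂ (map₁ (Equivalence.to (language⇔ _))))
                            (map₂ (map₁ (Equivalence.from (language⇔ _))))))
    where
    language⇔ : ∀ w → L w ⇔ Any (w ∈ᴾ_) Ps
    language⇔ w = ⇔.trans (D-recognises-L w) (accepts⇔ w)
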